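{- (Length Function Theorem for Ordinals.) Let $g:\mathbb{N}\to\mathbb{N}$ be monotone and expansive, let $\alpha<\varepsilon_0$, and let $x\in\mathbb{N}$ with $x\geq N\alpha$. Then $L_{g,\alpha}(x)=g_\alpha(x)$.
   Context: A function $g:\mathbb{N}\to\mathbb{N}$ is monotone if $x\leq x'$ implies $g(x)\leq g(x')$, and expansive if $x\leq g(x)$; $g^i$ is its $i$-th iterate. Ordinals below $\varepsilon_0$ are terms in Cantor normal form $\alpha=\omega^{\alpha_1}\cdot c_1+\cdots+\omega^{\alpha_p}\cdot c_p$ with $\alpha>\alpha_1>\cdots>\alpha_p$ and $0<c_1,\dots,c_p<\omega$; the norm is $N\alpha=\max\{c_1,\dots,c_p,N\alpha_1,\dots,N\alpha_p\}$ ($N0=0$). The ordinal $\alpha$ is identified with the set of ordinals below it, ordered by the usual ordinal order and normed by $N$. A sequence $\beta_0,\beta_1,\dots$ of ordinals in $\alpha$ is bad iff it is strictly decreasing ($\beta_0>\beta_1>\cdots$), and it is $(g,n)$-controlled if $N\beta_i\leq g^i(n)$ for all $i$. $L_{g,\alpha}(n)$ denotes the maximal length of a $(g,n)$-controlled bad sequence over $\alpha$. Fundamental sequences: for a limit written $\gamma+\omega^{\beta}$ ($\beta$ the last CNF exponent), $(\gamma+\omega^{\beta+1})(x)=\gamma+\omega^{\beta}\cdot(x+1)$ and $(\gamma+\omega^{\lambda})(x)=\gamma+\omega^{\lambda(x)}$ for limit $\lambda$. Predecessor of $\alpha>0$: $P_x(\alpha+1)=\alpha$, $P_x(\lambda)=P_x(\lambda(x))$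 for limit $\lambda$. Cichoń hierarchy: $g_0(x)=0$ and $g_\alpha(x)=1+g_{P_x(\alpha)}(g(x))$ for $0<\alpha<\varepsilon_0$. -}

module Defs where

open import Data.Nat using (ℕ; zero; suc; _≤_; _<_; _⊔_)
open import Data.Product using (Σ; _×_)
open import Relation.Binary.PropositionalEquality using (_≡_)

-- Ordinal terms below ε₀ in Cantor normal form:
-- 𝟎 is 0, and  ω^ a · c + r  is  ω^a·c + r  (r the remaining CNF terms).
data Ord : Set where
  𝟎     : Ord
  ω^_·_+_ : Ord → ℕ → Ord → Ord

-- The (syntactic, lexicographic) ordinal order on terms; it is the usual
-- ordinal order on Cantor-normal-form terms.
data _<ₒ_ : Ord → Ord → Set where
  0<ω   : ∀ {a c r} → 𝟎 <ₒ (ω^ a · c + r)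
  exp<  : ∀ {a c r a' c' r'} → a <ₒ a' → (ω^ a · c + r) <ₒ (ω^ a' · c' + r')
  coef< : ∀ {a c r c' r'} → c < c' → (ω^ a · c + r) <ₒ (ω^ a · c' + r')
  rest< : ∀ {a c r r'} → r <ₒ r' → (ω^ a · c + r) <ₒ (ω^ a · c + r')

data TailBelow (a : Ord) : Ord → Set where
  tb𝟎 : TailBelow a 𝟎
  tbω : ∀ {b d s} → b <ₒ a → TailBelow a (ω^ b · d + s)

data IsCNF : Ord → Set where
  cnf𝟎 : IsCNF 𝟎
  cnfω : ∀ {a c r} → IsCNF a → 0 < c → IsCNF r → TailBelow a r →
         IsCNF (ω^ a · c + r)

N : Ord → ℕ
N 𝟎 = 0
N (ω^ a · c + r) = c ⊔ (N a ⊔ N r)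

data Kind : Set where
  isZero isSucc isLim : Kind

kind : Ord → Kind
kind 𝟎 = isZero
kind (ω^ a · c + (ω^ b · d + s)) = kind (ω^ b · d + s)
kind (ω^ 𝟎 · c + 𝟎) = isSucc
kind (ω^ (ω^ _ · _ + _) · c + 𝟎) = isLim

predS : Ord → Ord
predS 𝟎 = 𝟎
predS (ω^ a · c + (ω^ b · d + s)) = ω^ a · c + predS (ω^ b · d + s)
predS (ω^ 𝟎 · suc (suc c) + 𝟎) = ω^ 𝟎 · suc c + 𝟎
predS (ω^ 𝟎 · _ + 𝟎) = 𝟎
predS (ω^ (ω^ a' · c' + r') · c + 𝟎) = ω^ (ω^ a' · c' + r') · c + 𝟎   -- not a successor (junk)

lead : Ord → ℕ → Ord → Ord
lead a (suc (suc c)) t = ω^ a · suc c + t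
lead a _ t = t

-- fundamental sequences:  (γ + ω^(β+1))(x) = γ + ω^β·(x+1),
--                         (γ + ω^λ)(x)     = γ + ω^(λ(x))   (λ limit)
fs : ℕ → Ord → Ord
fs x 𝟎 = 𝟎
fs x (ω^ a · c + (ω^ b · d + s)) = ω^ a · c + fs x (ω^ b · d + s)
fs x (ω^ a · c + 𝟎) = lead a c (lastPart (kind a))
  where
  lastPart : Kind → Ord
  lastPart isZero = 𝟎                               -- successor case (junk)
  lastPart isSucc = ω^ predS a · suc x + 𝟎
  lastPart isLim  = ω^ fs x a · 1 + 𝟎

-- Predecessor relation:  Pred x α β  means  P_x(α) = β,
-- with P_x(α+1) = α and P_x(λ) = P_x(λ(x)).
data Pred (x : ℕ) : Ord → Ord → Set where
  pSucc : ∀ {α} → kind α ≡ isSucc → Pred x α (predS α)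
  pLim  : ∀ {α β} → kind α ≡ isLim → Pred x (fs x α) β → Pred x α β

-- Cichoń hierarchy as its graph:  Cichon g α x n  means  g_α(x) = n,
-- with g_0(x) = 0 and g_α(x) = 1 + g_{P_x(α)}(g(x)) for α > 0.
data Cichon (g : ℕ → ℕ) : Ord → ℕ → ℕ → Set where
  ch𝟎 : ∀ {x} → Cichon g 𝟎 x 0
  chP : ∀ {α β x n} → Pred x α β → Cichon g β (g x) n → Cichon g α x (suc n)

iter : (ℕ → ℕ) → ℕ → ℕ → ℕ
iter g zero n = n
iter g (suc i) n = g (iter g i n)

Monotone : (ℕ → ℕ) → Set
Monotone g = ∀ {a b} → a ≤ b → g a ≤ g b

Expansive : (ℕ → ℕ) → Set
Expansive g = ∀ a → a ≤ g a

ControlledBad : (ℕ → ℕ) → ℕ → Ord → ℕ → (ℕ → Ord) → Set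
ControlledBad g n α ℓ β =
  (∀ i → i < ℓ → IsCNF (β i) × (β i <ₒ α) × (N (β i) ≤ iter g i n)) ×
  (∀ i → suc i < ℓ → β (suc i) <ₒ β i)

-- m is the maximal length of a (g,n)-controlled bad sequence over α:
-- L_{g,α}(n) = m.
IsMaxBadLength : (ℕ → ℕ) → Ord → ℕ → ℕ → Set
IsMaxBadLength g α n m =
  Σ (ℕ → Ord) (λ β → ControlledBad g n α m β) ×
  (∀ ℓ β → ControlledBad g n α ℓ β → ℓ ≤ m)

-- The whole argument rests on one property of the predecessor P_x:
-- for a CNF term α > 0 with N α ≤ x, the ordinal P_x(α) is the LARGEST
-- CNF ordinal below α whose norm is at most x.  Granting this, a
-- (g,x)-controlled bad sequence over α is a first element β₀ ≤ P_x(α)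
-- followed by a (g,g(x))-controlled bad sequence over β₀, hence over
-- P_x(α); and the choice β₀ = P_x(α) is optimal.  Both L_{g,α} and g_α thus
-- satisfy the recursion  f_α(x) = 1 + f_{P_x(α)}(g x),  f_𝟎 = 0.
module Submission where

open import Defs
open import Data.Nat using (ℕ; _≤_)
open import Data.Product using (Σ; _×_)
open import Data.Nat using (zero; suc; _<_; z≤n; s≤s)
open import Data.Nat.Properties
  using (≤-refl; ≤-trans; <-trans; n≤1+n; n<1+n; m<1+n⇒m<n∨m≡n; m⊔n≤o⇒m≤o; m⊔n≤o⇒n≤o; ⊔-lub)
open import Data.Nat.Induction using (<-wellFounded)
open import Induction.WellFounded using (Acc; acc; WellFounded)
open import Data.Product using (_,_; map; map₂)
open import Data.Sum using (_⊎_; inj₁; inj₂)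
open import Data.Empty using (⊥; ⊥-elim)
open import Relation.Binary.PropositionalEquality using (_≡_; refl; sym; cong; subst)

<ₒ-trans : ∀ {α β γ} → α <ₒ β → β <ₒ γ → α <ₒ γ
<ₒ-trans 0<ω       (exp< q)  = 0<ω
<ₒ-trans 0<ω       (coef< q) = 0<ω
<ₒ-trans 0<ω       (rest< q) = 0<ω
<ₒ-trans (exp< p)  (exp< q)  = exp< (<ₒ-trans p q)
<ₒ-trans (exp< p)  (coef< q) = exp< p
<ₒ-trans (exp< p)  (rest< q) = exp< p
<ₒ-trans (coef< p) (exp< q)  = exp< q
<ₒ-trans (coef< p) (coef< q) = coef< (<-trans p q)
<ₒ-trans (coef< p) (rest< q) = coef< p
<ₒ-trans (rest< p) (exp< q)  = exp< q
<ₒ-trans (rest< p) (coef< q) = coef< q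
<ₒ-trans (rest< p) (rest< q) = rest< (<ₒ-trans p q)

_≤ₒ_ : Ord → Ord → Set
α ≤ₒ β = α ≡ β ⊎ α <ₒ β

<ₒ-≤ₒ-trans : ∀ {α β γ} → α <ₒ β → β ≤ₒ γ → α <ₒ γ
<ₒ-≤ₒ-trans p (inj₁ refl) = p
<ₒ-≤ₒ-trans p (inj₂ q)    = <ₒ-trans p q

nonzero-kind : ∀ a c r → kind (ω^ a · c + r) ≡ isZero → ⊥
nonzero-kind a c (ω^ b · d + s) k = nonzero-kind b d s k
nonzero-kind 𝟎 c 𝟎 ()
nonzero-kind (ω^ _ · _ + _) c 𝟎 ()

TailBelow-weaken : ∀ {a b t} → TailBelow b t → b <ₒ a → TailBelow a t
TailBelow-weaken tb𝟎     _ = tb𝟎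
TailBelow-weaken (tbω p) q = tbω (<ₒ-trans p q)

norm-coef : ∀ b d s {x} → N (ω^ b · d + s) ≤ x → d ≤ x
norm-coef b d s h = m⊔n≤o⇒m≤o d _ h

norm-exp : ∀ b d s {x} → N (ω^ b · d + s) ≤ x → N b ≤ x
norm-exp b d s h = m⊔n≤o⇒m≤o (N b) (N s) (m⊔n≤o⇒n≤o d _ h)

norm-rest : ∀ b d s {x} → N (ω^ b · d + s) ≤ x → N s ≤ x
norm-rest b d s h = m⊔n≤o⇒n≤o (N b) (N s) (m⊔n≤o⇒n≤o d _ h)

predS-< : ∀ α → kind α ≡ isSucc → predS α <ₒ α
predS-< (ω^ a · c + (ω^ b · d + s))  k = rest< (predS-< (ω^ b · d + s) k)
predS-< (ω^ 𝟎 · zero + 𝟎)            k = 0<ω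
predS-< (ω^ 𝟎 · suc zero + 𝟎)        k = 0<ω
predS-< (ω^ 𝟎 · suc (suc c) + 𝟎)     k = coef< ≤-refl
predS-< (ω^ (ω^ _ · _ + _) · c + 𝟎) ()

predS-tail : ∀ {a} r → kind r ≡ isSucc → TailBelow a r → TailBelow a (predS r)
predS-tail (ω^ b · d + (ω^ _ · _ + _)) k (tbω p) = tbω p
predS-tail (ω^ 𝟎 · zero + 𝟎)            k _       = tb𝟎
predS-tail (ω^ 𝟎 · suc zero + 𝟎)        k _       = tb𝟎
predS-tail (ω^ 𝟎 · suc (suc c) + 𝟎)     k (tbω p) = tbω p
predS-tail (ω^ (ω^ _ · _ + _) · c + 𝟎) ()

predS-cnf : ∀ α → kind α ≡ isSucc → IsCNF α → IsCNF (predS α)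
predS-cnf (ω^ a · c + (ω^ b · d + s)) k (cnfω ca cc cr tb) =
  cnfω ca cc (predS-cnf (ω^ b · d + s) k cr) (predS-tail _ k tb)
predS-cnf (ω^ 𝟎 · zero + 𝟎)            k _ = cnf𝟎
predS-cnf (ω^ 𝟎 · suc zero + 𝟎)        k _ = cnf𝟎
predS-cnf (ω^ 𝟎 · suc (suc c) + 𝟎)     k (cnfω ca _ cr tb) = cnfω ca (s≤s z≤n) cr tb
predS-cnf (ω^ (ω^ _ · _ + _) · c + 𝟎) ()

predS-max : ∀ α → kind α ≡ isSucc → IsCNF α → ∀ {β} → IsCNF β → β <ₒ α → β ≤ₒ predS α
predS-max (ω^ a · c + (ω^ b · d + s)) k _ _ 0<ω       = inj₂ 0<ω
predS-max (ω^ a · c + (ω^ b · d + s)) k _ _ (exp< p)  = inj₂ (exp< p)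
predS-max (ω^ a · c + (ω^ b · d + s)) k _ _ (coef< p) = inj₂ (coef< p)
predS-max (ω^ a · c + (ω^ b · d + s)) k (cnfω _ _ cr _) (cnfω _ _ cs _) (rest< p)
  with predS-max (ω^ b · d + s) k cr cs p
... | inj₁ refl = inj₁ refl
... | inj₂ q    = inj₂ (rest< q)
predS-max (ω^ 𝟎 · zero + 𝟎) k (cnfω _ () _ _)
predS-max (ω^ 𝟎 · suc zero + 𝟎) k _ _ 0<ω = inj₁ refl
predS-max (ω^ 𝟎 · suc zero + 𝟎) k _ (cnfω _ () _ _) (coef< (s≤s z≤n))
predS-max (ω^ 𝟎 · suc (suc c) + 𝟎) k _ _ 0<ω = inj₂ 0<ω
predS-max (ω^ 𝟎 · suc (suc c) + 𝟎) k _ (cnfω _ _ _ tb) (coef< p)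
  with m<1+n⇒m<n∨m≡n p | tb
... | inj₁ q    | _   = inj₂ (coef< q)
... | inj₂ refl | tb𝟎 = inj₁ refl
predS-max (ω^ (ω^ _ · _ + _) · c + 𝟎) ()

fsLast : ℕ → Ord → Kind → Ord
fsLast x a isZero = 𝟎
fsLast x a isSucc = ω^ predS a · suc x + 𝟎
fsLast x a isLim  = ω^ fs x a · 1 + 𝟎

fs-single : ∀ x a c → fs x (ω^ a · c + 𝟎) ≡ lead a c (fsLast x a (kind a))
fs-single x a c with kind a
... | isZero = refl
... | isSucc = refl
... | isLim  = refl

lead-< : ∀ {a} c {t} → TailBelow a t → lead a c t <ₒ (ω^ a · c + 𝟎)
lead-< zero          tb𝟎     = 0<ω
lead-< zero          (tbω p) = exp< p
lead-< (suc zero)    tb𝟎     = 0<ω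
lead-< (suc zero)    (tbω p) = exp< p
lead-< (suc (suc c)) _       = coef< ≤-refl

lead-tail : ∀ {a b} d {t} → TailBelow b t → b <ₒ a → TailBelow a (lead b d t)
lead-tail zero          tb p = TailBelow-weaken tb p
lead-tail (suc zero)    tb p = TailBelow-weaken tb p
lead-tail (suc (suc d)) tb p = tbω p

lead-cnf : ∀ {b} d {t} → IsCNF b → 0 < d → IsCNF t → TailBelow b t → IsCNF (lead b d t)
lead-cnf (suc zero)    cb _ ct tb = ct
lead-cnf (suc (suc d)) cb _ ct tb = cnfω cb (s≤s z≤n) ct tb

mutual
  fs-< : ∀ x α → kind α ≡ isLim → fs x α <ₒ α
  fs-< x (ω^ a · c + (ω^ b · d + s)) k = rest< (fs-< x _ k)
  fs-< x (ω^ 𝟎 · c + 𝟎) ()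
  fs-< x (ω^ (ω^ a₁ · c₁ + r₁) · c + 𝟎) k =
    subst (_<ₒ _) (sym (fs-single x _ c))
      (lead-< c (fsLast-tail x _ (nonzero-kind a₁ c₁ r₁)))

  fsLast-tail : ∀ x a → (kind a ≡ isZero → ⊥) → TailBelow a (fsLast x a (kind a))
  fsLast-tail x a nz with kind a in k
  ... | isZero = ⊥-elim (nz refl)
  ... | isSucc = tbω (predS-< a k)
  ... | isLim  = tbω (fs-< x a k)

fs-tail : ∀ x {a} r → kind r ≡ isLim → TailBelow a r → TailBelow a (fs x r)
fs-tail x (ω^ b · d + (ω^ _ · _ + _)) k (tbω p) = tbω p
fs-tail x (ω^ 𝟎 · d + 𝟎) ()
fs-tail x (ω^ (ω^ a₁ · c₁ + r₁) · d + 𝟎) k (tbω p) =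
  subst (TailBelow _) (sym (fs-single x _ d))
    (lead-tail d (fsLast-tail x _ (nonzero-kind a₁ c₁ r₁)) p)

mutual
  fs-cnf : ∀ x α → kind α ≡ isLim → IsCNF α → IsCNF (fs x α)
  fs-cnf x (ω^ a · c + (ω^ b · d + s)) k (cnfω ca cc cr tb) =
    cnfω ca cc (fs-cnf x _ k cr) (fs-tail x _ k tb)
  fs-cnf x (ω^ 𝟎 · c + 𝟎) ()
  fs-cnf x (ω^ (ω^ a₁ · c₁ + r₁) · c + 𝟎) k (cnfω ca cc _ _) =
    subst IsCNF (sym (fs-single x _ c))
      (lead-cnf c ca cc (fsLast-cnf x _ nz ca) (fsLast-tail x _ nz))
    where nz = nonzero-kind a₁ c₁ r₁

  fsLast-cnf : ∀ x a → (kind a ≡ isZero → ⊥) → IsCNF a → IsCNF (fsLast x a (kind a))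
  fsLast-cnf x a nz ca with kind a in k
  ... | isZero = ⊥-elim (nz refl)
  ... | isSucc = cnfω (predS-cnf a k ca) (s≤s z≤n) cnf𝟎 tb𝟎
  ... | isLim  = cnfω (fs-cnf x a k ca) (s≤s z≤n) cnf𝟎 tb𝟎

mutual
  fs-bound : ∀ x α → kind α ≡ isLim → IsCNF α →
             ∀ {β} → IsCNF β → N β ≤ x → β <ₒ α → β <ₒ fs x α
  fs-bound x (ω^ a · c + (ω^ b · d + s)) k _ _ _ 0<ω       = 0<ω
  fs-bound x (ω^ a · c + (ω^ b · d + s)) k _ _ _ (exp< p)  = exp< p
  fs-bound x (ω^ a · c + (ω^ b · d + s)) k _ _ _ (coef< p) = coef< p
  fs-bound x (ω^ a · c + (ω^ b · d + s)) k (cnfω _ _ cr _) (cnfω {a'} {c'} {s'} _ _ cs _) h (rest< p) =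
    rest< (fs-bound x _ k cr cs (norm-rest a' c' s' h) p)
  fs-bound x (ω^ 𝟎 · c + 𝟎) ()
  fs-bound x (ω^ (ω^ a₁ · c₁ + r₁) · c + 𝟎) k cα cβ h p =
    subst (_ <ₒ_) (sym (fs-single x _ c)) (single-bound x _ (nonzero-kind a₁ c₁ r₁) c cα cβ h p)

  single-bound : ∀ x a → (kind a ≡ isZero → ⊥) → ∀ c → IsCNF (ω^ a · c + 𝟎) →
                 ∀ {β} → IsCNF β → N β ≤ x → β <ₒ (ω^ a · c + 𝟎) →
                 β <ₒ lead a c (fsLast x a (kind a))
  single-bound x a nz zero (cnfω _ () _ _)
  single-bound x a nz (suc zero) (cnfω ca _ _ _) _ _ 0<ω =
    fsLast-bound x a nz ca cnf𝟎 tb𝟎 z≤n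
  single-bound x a nz (suc zero) (cnfω ca _ _ _) cβ h (exp< p) =
    fsLast-bound x a nz ca cβ (tbω p) h
  single-bound x a nz (suc zero) _ (cnfω _ () _ _) _ (coef< (s≤s z≤n))
  single-bound x a nz (suc (suc c)) _ _ _ 0<ω      = 0<ω
  single-bound x a nz (suc (suc c)) _ _ _ (exp< p) = exp< p
  single-bound x a nz (suc (suc c)) (cnfω ca _ _ _) (cnfω {b} {d} {s} _ _ cs tbs) h (coef< p)
    with m<1+n⇒m<n∨m≡n p
  ... | inj₁ q    = coef< q
  ... | inj₂ refl = rest< (fsLast-bound x a nz ca cs tbs (norm-rest b d s h))

  fsLast-bound : ∀ x a → (kind a ≡ isZero → ⊥) → IsCNF a →
                 ∀ {γ} → IsCNF γ → TailBelow a γ → N γ ≤ x → γ <ₒ fsLast x a (kind a)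
  fsLast-bound x a nz ca cγ tb h with kind a in k
  ... | isZero = ⊥-elim (nz refl)
  fsLast-bound x a nz ca _ tb𝟎 h | isSucc = 0<ω
  fsLast-bound x a nz ca (cnfω {b} {d} {s} cb _ _ _) (tbω p) h | isSucc
    with predS-max a k ca cb p
  ... | inj₁ refl = coef< (s≤s (norm-coef b d s h))
  ... | inj₂ q    = exp< q
  fsLast-bound x a nz ca _ tb𝟎 h | isLim = 0<ω
  fsLast-bound x a nz ca (cnfω {b} {d} {s} cb _ _ _) (tbω p) h | isLim =
    exp< (fs-bound x a k ca cb (norm-exp b d s h) p)

-- These are the shapes that fundamental sequences
-- produce from terms of norm ≤ x, and predecessors of such successors have
-- norm ≤ x; this invariant yields N(P_x α) ≤ x.
data NearNorm (x : ℕ) : Ord → Set where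
  near𝟎    : NearNorm x 𝟎
  nearTerm : ∀ {a c r} → N a ≤ x → c ≤ x → NearNorm x r → NearNorm x (ω^ a · c + r)
  nearCoef : ∀ {a c} → N a ≤ x → c ≤ suc x → NearNorm x (ω^ a · c + 𝟎)
  nearExp  : ∀ {a} → NearNorm x a → NearNorm x (ω^ a · 1 + 𝟎)

norm⇒near : ∀ {x} α → N α ≤ x → NearNorm x α
norm⇒near 𝟎 h = near𝟎
norm⇒near (ω^ a · c + r) h =
  nearTerm (norm-exp a c r h) (norm-coef a c r h) (norm⇒near r (norm-rest a c r h))

predS-norm : ∀ {x} α → kind α ≡ isSucc → NearNorm x α → N (predS α) ≤ x
predS-norm (ω^ a · c + (ω^ b · d + s)) k (nearTerm na nc nr) =
  ⊔-lub nc (⊔-lub na (predS-norm _ k nr))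
predS-norm (ω^ 𝟎 · zero + 𝟎)            k _ = z≤n
predS-norm (ω^ 𝟎 · suc zero + 𝟎)        k _ = z≤n
predS-norm (ω^ 𝟎 · suc (suc c) + 𝟎)     k (nearTerm _ nc _)     = ≤-trans (n≤1+n _) nc
predS-norm (ω^ 𝟎 · suc (suc c) + 𝟎)     k (nearCoef _ (s≤s nc)) = nc
predS-norm (ω^ (ω^ _ · _ + _) · c + 𝟎) ()

lead-near : ∀ {x a} c {t} → N a ≤ x → c ≤ suc x → NearNorm x t → NearNorm x (lead a c t)
lead-near zero          na hc       nt = nt
lead-near (suc zero)    na hc       nt = nt
lead-near (suc (suc c)) na (s≤s hc) nt = nearTerm na hc nt

mutual
  fs-near : ∀ x α → kind α ≡ isLim → NearNorm x α → NearNorm x (fs x α)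
  fs-near x (ω^ a · c + (ω^ b · d + s)) k (nearTerm na nc nr) = nearTerm na nc (fs-near x _ k nr)
  fs-near x (ω^ 𝟎 · c + 𝟎) ()
  fs-near x (ω^ (ω^ a₁ · c₁ + r₁) · c + 𝟎) k (nearTerm na nc _) =
    subst (NearNorm x) (sym (fs-single x _ c))
      (lead-near c na (≤-trans nc (n≤1+n _)) (fsLast-near x _ (nonzero-kind a₁ c₁ r₁) (norm⇒near _ na)))
  fs-near x (ω^ (ω^ a₁ · c₁ + r₁) · c + 𝟎) k (nearCoef na nc) =
    subst (NearNorm x) (sym (fs-single x _ c))
      (lead-near c na nc (fsLast-near x _ (nonzero-kind a₁ c₁ r₁) (norm⇒near _ na)))
  fs-near x (ω^ (ω^ a₁ · c₁ + r₁) · 1 + 𝟎) k (nearExp na) =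
    subst (NearNorm x) (sym (fs-single x _ 1)) (fsLast-near x _ (nonzero-kind a₁ c₁ r₁) na)

  fsLast-near : ∀ x a → (kind a ≡ isZero → ⊥) → NearNorm x a → NearNorm x (fsLast x a (kind a))
  fsLast-near x a nz na with kind a in k
  ... | isZero = ⊥-elim (nz refl)
  ... | isSucc = nearCoef (predS-norm a k na) ≤-refl
  ... | isLim  = nearExp (fs-near x a k na)

pred-below : ∀ {x α β} → Pred x α β → IsCNF α → IsCNF β × β <ₒ α
pred-below {α = α} (pSucc k) cα = predS-cnf α k cα , predS-< α k
pred-below {x} {α} (pLim k p) cα with pred-below p (fs-cnf x α k cα)
... | cβ , β<fs = cβ , <ₒ-trans β<fs (fs-< x α k)

pred-norm : ∀ {x α β} → Pred x α β → NearNorm x α → N β ≤ x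
pred-norm {α = α} (pSucc k) nα = predS-norm α k nα
pred-norm {x} {α} (pLim k p) nα = pred-norm p (fs-near x α k nα)

pred-max : ∀ {x α γ β} → Pred x α γ → IsCNF α → IsCNF β → N β ≤ x → β <ₒ α → β ≤ₒ γ
pred-max {α = α} (pSucc k) cα cβ h β<α = predS-max α k cα cβ β<α
pred-max {x} {α} (pLim k p) cα cβ h β<α =
  pred-max p (fs-cnf x α k cα) cβ h (fs-bound x α k cα cβ h β<α)

_⊏_ : Ord → Ord → Set
β ⊏ α = IsCNF β × β <ₒ α

𝟎-acc : Acc _⊏_ 𝟎
𝟎-acc = acc λ { (_ , ()) }

TailsAccessible : Ord → Set
TailsAccessible a = ∀ t → IsCNF t → TailBelow a t → Acc _⊏_ t

below-term-acc : ∀ {b} → TailsAccessible b → ∀ {c r} → Acc _<_ c → Acc _⊏_ r →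
                 ∀ {β} → β ⊏ (ω^ b · c + r) → Acc _⊏_ β
below-term-acc tails _ _ (_ , 0<ω)      = 𝟎-acc
below-term-acc tails _ _ (cβ , exp< p)  = tails _ cβ (tbω p)
below-term-acc tails (acc rsC) _ (cnfω _ _ cs tbs , coef< p) =
  acc (below-term-acc tails (rsC p) (tails _ cs tbs))
below-term-acc tails accC@(acc _) (acc rsR) (cnfω _ _ cs _ , rest< p) =
  acc (below-term-acc tails accC (rsR (cs , p)))

tails-acc : ∀ a → Acc _⊏_ a → TailsAccessible a
tails-acc a _ 𝟎 _ _ = 𝟎-acc
tails-acc a (acc rs) (ω^ b · c + r) (cnfω cb _ cr tbr) (tbω b<a) =
  acc (below-term-acc tailsB (<-wellFounded c) (tailsB r cr tbr))
  where tailsB = tails-acc b (rs (cb , b<a))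

⊏-wellFounded : WellFounded _⊏_
⊏-wellFounded 𝟎 = 𝟎-acc
⊏-wellFounded (ω^ a · c + r) =
  acc (below-term-acc (tails-acc a (⊏-wellFounded a)) (<-wellFounded c) (⊏-wellFounded r))

-- P_x(α) exists for every CNF α > 0: unfolding fundamental sequences
-- terminates since they descend, and never reaches 𝟎 since 𝟎 < λ(x).
pred-exists : ∀ x α → Acc _⊏_ α → IsCNF α → 𝟎 <ₒ α → Σ Ord (Pred x α)
pred-exists x α@(ω^ a · c + r) (acc rs) cα 0<α with kind α in k
... | isZero = ⊥-elim (nonzero-kind a c r k)
... | isSucc = predS α , pSucc k
... | isLim = map₂ (pLim k)
  (pred-exists x (fs x α) (rs (cfs , fs-< x α k)) cfs (fs-bound x α k cα cnf𝟎 z≤n 0<α))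
  where cfs = fs-cnf x α k cα

-- g_α(x) is defined whenever α is CNF, N α ≤ x and g is expansive
-- (expansiveness keeps the norm bound N(P_x α) ≤ x ≤ g x).
cichon-exists : ∀ g → Expansive g → ∀ α → Acc _⊏_ α → IsCNF α →
                ∀ x → N α ≤ x → Σ ℕ (Cichon g α x)
cichon-exists g e 𝟎 _ _ x h = 0 , ch𝟎
cichon-exists g e α@(ω^ _ · _ + _) accα@(acc rs) cα x h
  with pred-exists x α accα cα 0<ω
... | β , p with pred-below p cα
...   | cβ , β<α = map suc (chP p)
  (cichon-exists g e β (rs (cβ , β<α)) cβ (g x) (≤-trans (pred-norm p (norm⇒near α h)) (e x)))

iter-shift : ∀ g i x → iter g i (g x) ≡ iter g (suc i) x
iter-shift g zero    x = refl
iter-shift g (suc i) x = cong g (iter-shift g i x)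

_◂_ : Ord → (ℕ → Ord) → ℕ → Ord
(γ ◂ s) zero    = γ
(γ ◂ s) (suc i) = s i

bad-cons : ∀ g {x α γ n s} → IsCNF γ → γ <ₒ α → N γ ≤ x →
           ControlledBad g (g x) γ n s → ControlledBad g x α (suc n) (γ ◂ s)
bad-cons g {x} {α} {γ} {n} {s} cγ γ<α nγ (elems , descends) = elems′ , descends′
  where
  elems′ : ∀ i → i < suc n → IsCNF ((γ ◂ s) i) × ((γ ◂ s) i <ₒ α) × (N ((γ ◂ s) i) ≤ iter g i x)
  elems′ zero    _         = cγ , γ<α , nγ
  elems′ (suc i) (s≤s i<n) with elems i i<n
  ... | cs , s<γ , ns = cs , <ₒ-trans s<γ γ<α , subst (N (s i) ≤_) (iter-shift g i x) ns

  descends′ : ∀ i → suc i < suc n → (γ ◂ s) (suc i) <ₒ (γ ◂ s) i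
  descends′ zero    (s≤s 0<n) with elems 0 0<n
  ... | _ , s₀<γ , _ = s₀<γ
  descends′ (suc i) (s≤s i<n) = descends i i<n

below-head : ∀ {ℓ} (β : ℕ → Ord) → (∀ i → suc i < ℓ → β (suc i) <ₒ β i) →
             ∀ i → suc i < ℓ → β (suc i) <ₒ β 0
below-head β descends zero    h = descends 0 h
below-head β descends (suc i) h =
  <ₒ-trans (descends (suc i) h) (below-head β descends i (<-trans (n<1+n _) h))

bad-tail : ∀ g {x α ℓ γ} β → ControlledBad g x α (suc ℓ) β → β 0 ≤ₒ γ →
           ControlledBad g (g x) γ ℓ (λ i → β (suc i))
bad-tail g {x} {α} {ℓ} {γ} β (elems , descends) β₀≤γ = elems′ , λ i h → descends (suc i) (s≤s h)
  where
  elems′ : ∀ i → i < ℓ → IsCNF (β (suc i)) × (β (suc i) <ₒ γ) × (N (β (suc i)) ≤ iter g i (g x))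
  elems′ i i<ℓ with elems (suc i) (s≤s i<ℓ)
  ... | cβ , _ , nβ = cβ , <ₒ-≤ₒ-trans (below-head β descends i (s≤s i<ℓ)) β₀≤γ ,
                      subst (N (β (suc i)) ≤_) (sym (iter-shift g i x)) nβ

-- Lower bound L_{g,α}(x) ≥ g_α(x): the iterated predecessors
-- P_x(α), P_{g x}(P_x α), … form a controlled bad sequence of length g_α(x).
cichon-bad : ∀ g → Expansive g → ∀ {α x n} → Cichon g α x n → IsCNF α → N α ≤ x →
             Σ (ℕ → Ord) (ControlledBad g x α n)
cichon-bad g e ch𝟎 _ _ = (λ _ → 𝟎) , (λ _ ()) , (λ _ ())
cichon-bad g e {α} {x} (chP {β = β} p ch) cα h with pred-below p cα
... | cβ , β<α = map (β ◂_) (bad-cons g cβ β<α nβ) (cichon-bad g e ch cβ (≤-trans nβ (e x)))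
  where nβ = pred-norm p (norm⇒near α h)

-- Upper bound L_{g,α}(x) ≤ g_α(x): the first element of a controlled bad
-- sequence is at most P_x(α), and the rest is controlled from g x.
bad-≤-cichon : ∀ g {α x n} → Cichon g α x n → IsCNF α →
               ∀ ℓ β → ControlledBad g x α ℓ β → ℓ ≤ n
bad-≤-cichon g _ _ zero _ _ = z≤n
bad-≤-cichon g ch𝟎 _ (suc ℓ) β (elems , _) with elems 0 (s≤s z≤n)
... | _ , () , _
bad-≤-cichon g (chP p ch) cα (suc ℓ) β bad@(elems , _) with elems 0 (s≤s z≤n) | pred-below p cα
... | cβ₀ , β₀<α , nβ₀ | cγ , _ =
  s≤s (bad-≤-cichon g ch cγ ℓ _ (bad-tail g β bad (pred-max p cα cβ₀ nβ₀ β₀<α)))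

theorem3p3 : (g : ℕ → ℕ) → Monotone g → Expansive g →
             (α : Ord) → IsCNF α → (x : ℕ) → N α ≤ x →
             Σ ℕ (λ m → Cichon g α x m × IsMaxBadLength g α x m)
theorem3p3 g _ expansive α cα x h with cichon-exists g expansive α (⊏-wellFounded α) cα x h
... | m , gα = m , gα , cichon-bad g expansive gα cα h , bad-≤-cichon g gα cα
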